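{- Let $G$ be a finite group, $N$ a normal subgroup of $G$, and $S \subseteq G$ a $(|G|,k,\mu)$ sum set. If the center of $G/N$ contains an element which is not the square of any element of $G/N$, then $\mu \cdot |N|$ is even.
   Context: For $a \in G$, the number of ways to write $a$ as a product in $S$ is the number of ordered pairs $(x,y) \in S\times S$ with $xy = a$. $S$ (with $|S|=k$) is a $(|G|,k,\mu)$ sum set if every nonidentity element of $G$ can be written as a product in $S$ in exactly $\mu$ ways. -}

module Defs where

open import Data.Nat using (ℕ)
open import Data.Fin using (Fin)
open import Data.Fin.Properties using (_≟_)
open import Data.Fin.Subset using (Subset; _∈_; _∉_; ∣_∣)
open import Data.Fin.Subset.Properties using (_∈?_)
open import Data.List using (List; length; filter; cartesianProduct; allFin)
open import Data.Product using (_×_; _,_; ∃-syntax)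
open import Relation.Nullary using (¬_)
open import Relation.Nullary.Decidable using (_×-dec_)
open import Relation.Binary.PropositionalEquality using (_≡_)
open import Algebra.Structures using (IsGroup)

-- A finite group of order n: carrier Fin n (every finite group is
-- isomorphic to one of these), with propositional equality.
record FinGroup (n : ℕ) : Set where
  infixl 7 _∙_
  field
    _∙_     : Fin n → Fin n → Fin n
    ε       : Fin n
    _⁻¹     : Fin n → Fin n
    isGroup : IsGroup _≡_ _∙_ ε _⁻¹

module _ {n : ℕ} (G : FinGroup n) where
  open FinGroup G

  record IsNormalSubgroup (N : Subset n) : Set where
    field
      ε∈N    : ε ∈ N
      ∙-closed : ∀ {x y} → x ∈ N → y ∈ N → x ∙ y ∈ N
      ⁻¹-closed : ∀ {x} → x ∈ N → x ⁻¹ ∈ N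
      conj-closed : ∀ g {x} → x ∈ N → (g ∙ x) ∙ g ⁻¹ ∈ N

  -- equality of left cosets in G/N:  aN = bN  iff  a⁻¹ b ∈ N
  _≡[_]_ : Fin n → Subset n → Fin n → Set
  a ≡[ N ] b = a ⁻¹ ∙ b ∈ N

  CentralMod : Subset n → Fin n → Set
  CentralMod N g = ∀ h → (g ∙ h) ≡[ N ] (h ∙ g)

  SquareMod : Subset n → Fin n → Set
  SquareMod N g = ∃[ x ] (x ∙ x) ≡[ N ] g

  reps : Subset n → Fin n → ℕ
  reps S a = length (filter (λ p → (Data.Product.proj₁ p ∈? S) ×-dec
                                   ((Data.Product.proj₂ p ∈? S) ×-dec
                                    (Data.Product.proj₁ p ∙ Data.Product.proj₂ p ≟ a)))
                            (cartesianProduct (allFin n) (allFin n)))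

  IsSumSet : Subset n → ℕ → ℕ → Set
  IsSumSet S k μ = (∣ S ∣ ≡ k) × (∀ a → ¬ (a ≡ ε) → reps S a ≡ μ)

-- Count the pairs (x , y) ∈ S × S with x y ∈ g N, where g N is a central coset that is not a
-- square.  Sorting them by the value x y = g m (m ∈ N) gives |N| μ of them, because g m ≠ 1
-- (otherwise g N = 1² N).  On the other hand, centrality of g N makes "x y ∈ g N" symmetric in
-- x and y, and it fails for x = y since g N contains no square; so the pairs come in swapped
-- couples and their number is even.
module Submission where

open import Data.Bool.Base using (true; false; if_then_else_)
open import Data.Empty using (⊥-elim)
open import Data.Fin using (Fin; zero; suc)
open import Data.Fin.Properties using (_≟_)
open import Data.Fin.Subset using (Subset; ∣_∣; _∈_)
open import Data.Fin.Subset.Properties using (_∈?_)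
open import Data.List using (List; []; _∷_; _++_; map; filter; length; tabulate; allFin; cartesianProduct)
open import Data.List.Properties using (length-++; filter-++)
open import Data.Nat using (ℕ; zero; suc; _+_; _*_)
open import Data.Nat.Divisibility using (_∣_; _∣0; ∣m∣n⇒∣m+n; m∣m*n)
open import Data.Nat.Properties using (+-*-semiring; +-identityʳ; +-assoc; *-comm)
open import Data.Product using (_×_; _,_; ∃-syntax)
open import Data.Vec using ([]; _∷_)
open import Function using (_∘_; id)
open import Relation.Binary.PropositionalEquality
  using (_≡_; _≢_; refl; sym; trans; cong; cong₂; subst; module ≡-Reasoning)
open import Relation.Nullary using (Dec; does; yes; no; ¬_)
open import Relation.Nullary.Decidable using (_×-dec_)
open import Relation.Unary using (Pred; Decidable)
open import Level using (0ℓ)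
open import Algebra.Bundles using (Group)
open import Algebra.Structures using (IsGroup)
import Algebra.Properties.Group as GroupProperties
open import Defs

open import Algebra.Properties.Semiring.Sum +-*-semiring
  using (sum-syntax; sum-cong-≗; sum-replicate-zero; ∑-distrib-+; ∑-comm; *-distribˡ-sum; *-distribʳ-sum)

𝟙 : ∀ {p} {P : Set p} → Dec P → ℕ
𝟙 d = if does d then 1 else 0

𝟙-× : ∀ {p q} {P : Set p} {Q : Set q} (d : Dec P) (e : Dec Q) → 𝟙 (d ×-dec e) ≡ 𝟙 d * 𝟙 e
𝟙-× d e with does d | does e
... | true  | true  = refl
... | true  | false = refl
... | false | _     = refl

𝟙-cong : ∀ {p q} {P : Set p} {Q : Set q} (d : Dec P) (e : Dec Q) → (P → Q) → (Q → P) → 𝟙 d ≡ 𝟙 e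
𝟙-cong (yes _) (yes _) _   _   = refl
𝟙-cong (yes p) (no ¬q) P→Q _   = ⊥-elim (¬q (P→Q p))
𝟙-cong (no ¬p) (yes q) _   Q→P = ⊥-elim (¬p (Q→P q))
𝟙-cong (no _)  (no _)  _   _   = refl

𝟙-reject : ∀ {p} {P : Set p} (d : Dec P) → ¬ P → 𝟙 d ≡ 0
𝟙-reject (yes p) ¬p = ⊥-elim (¬p p)
𝟙-reject (no _)  _  = refl

𝟙-*-congˡ : ∀ {p} {P : Set p} (d : Dec P) {a b : ℕ} → (P → a ≡ b) → 𝟙 d * a ≡ 𝟙 d * b
𝟙-*-congˡ (yes p) P→a≡b = cong (1 *_) (P→a≡b p)
𝟙-*-congˡ (no _)  _     = refl

∑-δ : ∀ {n} (c : Fin n) (f : Fin n → ℕ) → ∑[ i < n ] (𝟙 (i ≟ c) * f i) ≡ f c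
∑-δ {suc n} zero    f = begin
  (f zero + 0) + ∑[ i < n ] 0 ≡⟨ cong₂ _+_ (+-identityʳ (f zero)) (sum-replicate-zero n) ⟩
  f zero + 0                  ≡⟨ +-identityʳ (f zero) ⟩
  f zero                      ∎
  where open ≡-Reasoning
∑-δ {suc n} (suc c) f = ∑-δ c (f ∘ suc)

2∣∑∑-symmetric-hollow : ∀ {n} (f : Fin n → Fin n → ℕ) → (∀ i j → f i j ≡ f j i) → (∀ i → f i i ≡ 0) →
          2 ∣ ∑[ i < n ] ∑[ j < n ] f i j
2∣∑∑-symmetric-hollow {zero}  f f-sym f-diag = 2 ∣0
2∣∑∑-symmetric-hollow {suc n} f f-sym f-diag =
  subst (2 ∣_) (sym split) (∣m∣n⇒∣m+n double (2∣∑∑-symmetric-hollow (λ i j → f (suc i) (suc j))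
                                                   (λ i j → f-sym (suc i) (suc j)) (f-diag ∘ suc)))
  where
  open ≡-Reasoning
  A R : ℕ
  A = ∑[ j < n ] f zero (suc j)
  R = ∑[ i < n ] ∑[ j < n ] f (suc i) (suc j)
  double : 2 ∣ A + A
  double = subst (λ z → 2 ∣ A + z) (+-identityʳ A) (m∣m*n A)
  split : ∑[ i < suc n ] ∑[ j < suc n ] f i j ≡ (A + A) + R
  split = begin
    (f zero zero + A) + ∑[ i < n ] (f (suc i) zero + ∑[ j < n ] f (suc i) (suc j))
      ≡⟨ cong₂ _+_ (cong (_+ A) (f-diag zero)) (∑-distrib-+ (λ i → f (suc i) zero) _) ⟩
    A + (∑[ i < n ] f (suc i) zero + R)
      ≡⟨ cong (λ s → A + (s + R)) (sum-cong-≗ (λ i → f-sym (suc i) zero)) ⟩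
    A + (A + R)
      ≡⟨ +-assoc A A R ⟨
    (A + A) + R ∎

∣p∣≡∑𝟙∈ : ∀ {n} (p : Subset n) → ∣ p ∣ ≡ ∑[ i < n ] 𝟙 (i ∈? p)
∣p∣≡∑𝟙∈ []            = refl
∣p∣≡∑𝟙∈ (true  ∷ p) = cong suc (∣p∣≡∑𝟙∈ p)
∣p∣≡∑𝟙∈ (false ∷ p) = ∣p∣≡∑𝟙∈ p

module _ {a p} {A : Set a} {P : Pred A p} (P? : Decidable P) where

  length-filter-tabulate : ∀ {n} (f : Fin n → A) → length (filter P? (tabulate f)) ≡ ∑[ i < n ] 𝟙 (P? (f i))
  length-filter-tabulate {zero}  f = refl
  length-filter-tabulate {suc n} f with does (P? (f zero))
  ... | true  = cong suc (length-filter-tabulate (f ∘ suc))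
  ... | false = length-filter-tabulate (f ∘ suc)

module _ {a b p} {A : Set a} {B : Set b} {P : Pred B p} (P? : Decidable P) where

  length-filter-map : ∀ (g : A → B) xs → length (filter P? (map g xs)) ≡ length (filter (P? ∘ g) xs)
  length-filter-map g []       = refl
  length-filter-map g (x ∷ xs) with does (P? (g x))
  ... | true  = cong suc (length-filter-map g xs)
  ... | false = length-filter-map g xs

module _ {a b p} {A : Set a} {B : Set b} {P : Pred (A × B) p} (P? : Decidable P) where

  length-filter-cartesianProduct : ∀ {n} (f : Fin n → A) (ys : List B) →
    length (filter P? (cartesianProduct (tabulate f) ys)) ≡ ∑[ i < n ] length (filter (P? ∘ (f i ,_)) ys)
  length-filter-cartesianProduct {zero}  f ys = refl
  length-filter-cartesianProduct {suc n} f ys = begin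
    length (filter P? (map (f zero ,_) ys ++ cartesianProduct (tabulate (f ∘ suc)) ys))
      ≡⟨ cong length (filter-++ P? (map (f zero ,_) ys) _) ⟩
    length (filter P? (map (f zero ,_) ys) ++ filter P? (cartesianProduct (tabulate (f ∘ suc)) ys))
      ≡⟨ length-++ (filter P? (map (f zero ,_) ys)) ⟩
    length (filter P? (map (f zero ,_) ys)) + length (filter P? (cartesianProduct (tabulate (f ∘ suc)) ys))
      ≡⟨ cong₂ _+_ (length-filter-map P? (f zero ,_) ys) (length-filter-cartesianProduct (f ∘ suc) ys) ⟩
    length (filter (P? ∘ (f zero ,_)) ys) + ∑[ i < n ] length (filter (P? ∘ (f (suc i) ,_)) ys) ∎
    where open ≡-Reasoning

length-filter-allFin² : ∀ {m n p} {P : Pred (Fin m × Fin n) p} (P? : Decidable P) →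
  length (filter P? (cartesianProduct (allFin m) (allFin n))) ≡ ∑[ i < m ] ∑[ j < n ] 𝟙 (P? (i , j))
length-filter-allFin² {n = n} P? =
  trans (length-filter-cartesianProduct P? id (allFin n))
        (sum-cong-≗ (λ i → length-filter-tabulate (λ j → P? (i , j)) id))

module _ {n : ℕ} (G : FinGroup n) where
  open FinGroup G
  open IsGroup isGroup using (assoc; identityˡ; _\\_)

  group : Group 0ℓ 0ℓ
  group = record { isGroup = isGroup }

  open GroupProperties group using (\\-leftDividesˡ; \\-leftDividesʳ; y≈x\\z; ⁻¹-anti-homo-∙; ⁻¹-involutive)

  factorisation? : (S : Subset n) (a x y : Fin n) → Dec (x ∈ S × y ∈ S × x ∙ y ≡ a)
  factorisation? S a x y = (x ∈? S) ×-dec ((y ∈? S) ×-dec (x ∙ y ≟ a))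

  reps≡∑∑ : ∀ S a → reps G S a ≡ ∑[ x < n ] ∑[ y < n ] 𝟙 (factorisation? S a x y)
  reps≡∑∑ S a = length-filter-allFin² (λ (x , y) → factorisation? S a x y)

  module Cosets (N : Subset n) where

    infix 4 _≡ᴺ_ _≡ᴺ?_

    _≡ᴺ_ : Fin n → Fin n → Set
    a ≡ᴺ b = _≡[_]_ G a N b

    _≡ᴺ?_ : ∀ a b → Dec (a ≡ᴺ b)
    a ≡ᴺ? b = a ⁻¹ ∙ b ∈? N

    coset-factorisation? : (S : Subset n) (g x y : Fin n) → Dec (x ∈ S × y ∈ S × g ≡ᴺ x ∙ y)
    coset-factorisation? S g x y = (x ∈? S) ×-dec ((y ∈? S) ×-dec (g ≡ᴺ? x ∙ y))

    ∑-factorisations-translate : ∀ S g x y →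
      ∑[ m < n ] (𝟙 (m ∈? N) * 𝟙 (factorisation? S (g ∙ m) x y)) ≡ 𝟙 (coset-factorisation? S g x y)
    ∑-factorisations-translate S g x y =
      trans (sum-cong-≗ term≡δ) (∑-δ (g \\ (x ∙ y)) (λ _ → 𝟙 (coset-factorisation? S g x y)))
      where
      open ≡-Reasoning
      m-unique : ∀ {m} → x ∙ y ≡ g ∙ m → m ≡ g \\ (x ∙ y)
      m-unique xy≡gm = y≈x\\z g _ (x ∙ y) (sym xy≡gm)
      m-solves : ∀ {m} → m ≡ g \\ (x ∙ y) → x ∙ y ≡ g ∙ m
      m-solves refl = sym (\\-leftDividesˡ g (x ∙ y))
      term≡δ : ∀ m → 𝟙 (m ∈? N) * 𝟙 (factorisation? S (g ∙ m) x y) ≡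
                     𝟙 (m ≟ g \\ (x ∙ y)) * 𝟙 (coset-factorisation? S g x y)
      term≡δ m = begin
        𝟙 (m ∈? N) * 𝟙 (factorisation? S (g ∙ m) x y)
          ≡⟨ 𝟙-× (m ∈? N) (factorisation? S (g ∙ m) x y) ⟨
        𝟙 ((m ∈? N) ×-dec factorisation? S (g ∙ m) x y)
          ≡⟨ 𝟙-cong ((m ∈? N) ×-dec factorisation? S (g ∙ m) x y)
                    ((m ≟ g \\ (x ∙ y)) ×-dec coset-factorisation? S g x y)
                    (λ (m∈N , x∈S , y∈S , xy≡gm) → let m≡ = m-unique xy≡gm in
                      m≡ , x∈S , y∈S , subst (_∈ N) m≡ m∈N)
                    (λ (m≡ , x∈S , y∈S , g≡xy) →
                      subst (_∈ N) (sym m≡) g≡xy , x∈S , y∈S , m-solves m≡) ⟩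
        𝟙 ((m ≟ g \\ (x ∙ y)) ×-dec coset-factorisation? S g x y)
          ≡⟨ 𝟙-× (m ≟ g \\ (x ∙ y)) (coset-factorisation? S g x y) ⟩
        𝟙 (m ≟ g \\ (x ∙ y)) * 𝟙 (coset-factorisation? S g x y) ∎

    ∑-reps-translate : ∀ S g → ∑[ m < n ] (𝟙 (m ∈? N) * reps G S (g ∙ m)) ≡
                                ∑[ x < n ] ∑[ y < n ] 𝟙 (coset-factorisation? S g x y)
    ∑-reps-translate S g = begin
      ∑[ m < n ] (𝟙 (m ∈? N) * reps G S (g ∙ m))
        ≡⟨ sum-cong-≗ distrib ⟩
      ∑[ m < n ] ∑[ x < n ] ∑[ y < n ] term m x y
        ≡⟨ ∑-comm (λ m x → ∑[ y < n ] term m x y) ⟩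
      ∑[ x < n ] ∑[ m < n ] ∑[ y < n ] term m x y
        ≡⟨ sum-cong-≗ (λ x → ∑-comm (λ m y → term m x y)) ⟩
      ∑[ x < n ] ∑[ y < n ] ∑[ m < n ] term m x y
        ≡⟨ sum-cong-≗ (λ x → sum-cong-≗ (λ y → ∑-factorisations-translate S g x y)) ⟩
      ∑[ x < n ] ∑[ y < n ] 𝟙 (coset-factorisation? S g x y) ∎
      where
      open ≡-Reasoning
      term : Fin n → Fin n → Fin n → ℕ
      term m x y = 𝟙 (m ∈? N) * 𝟙 (factorisation? S (g ∙ m) x y)
      distrib : ∀ m → 𝟙 (m ∈? N) * reps G S (g ∙ m) ≡ ∑[ x < n ] ∑[ y < n ] term m x y
      distrib m = begin
        𝟙 (m ∈? N) * reps G S (g ∙ m)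
          ≡⟨ cong (𝟙 (m ∈? N) *_) (reps≡∑∑ S (g ∙ m)) ⟩
        𝟙 (m ∈? N) * ∑[ x < n ] ∑[ y < n ] 𝟙 (factorisation? S (g ∙ m) x y)
          ≡⟨ *-distribˡ-sum (𝟙 (m ∈? N)) (λ x → ∑[ y < n ] 𝟙 (factorisation? S (g ∙ m) x y)) ⟩
        ∑[ x < n ] (𝟙 (m ∈? N) * ∑[ y < n ] 𝟙 (factorisation? S (g ∙ m) x y))
          ≡⟨ sum-cong-≗ (λ x → *-distribˡ-sum (𝟙 (m ∈? N)) (λ y → 𝟙 (factorisation? S (g ∙ m) x y))) ⟩
        ∑[ x < n ] ∑[ y < n ] term m x y ∎

    ≡ᴺ-respʳ : ∀ {a b c} → b ≡ c → a ≡ᴺ b → a ≡ᴺ c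
    ≡ᴺ-respʳ refl a≡b = a≡b

    ≡ᴺ-respˡ : ∀ {a b c} → a ≡ b → a ≡ᴺ c → b ≡ᴺ c
    ≡ᴺ-respˡ refl a≡c = a≡c

    ≡ᴺ-∙-congˡ : ∀ c {a b} → a ≡ᴺ b → c ∙ a ≡ᴺ c ∙ b
    ≡ᴺ-∙-congˡ c {a} {b} = subst (_∈ N) (sym (begin
      (c ∙ a) ⁻¹ ∙ (c ∙ b)     ≡⟨ cong (_∙ (c ∙ b)) (⁻¹-anti-homo-∙ c a) ⟩
      a ⁻¹ ∙ c ⁻¹ ∙ (c ∙ b)    ≡⟨ assoc (a ⁻¹) (c ⁻¹) (c ∙ b) ⟩
      a ⁻¹ ∙ (c ⁻¹ ∙ (c ∙ b))  ≡⟨ cong (a ⁻¹ ∙_) (\\-leftDividesʳ c b) ⟩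
      a ⁻¹ ∙ b                 ∎))
      where open ≡-Reasoning

    module Normal (N-normal : IsNormalSubgroup G N) where
      open IsNormalSubgroup N-normal

      ≡ᴺ-sym : ∀ {a b} → a ≡ᴺ b → b ≡ᴺ a
      ≡ᴺ-sym {a} {b} a≡b = subst (_∈ N) (begin
        (a ⁻¹ ∙ b) ⁻¹    ≡⟨ ⁻¹-anti-homo-∙ (a ⁻¹) b ⟩
        b ⁻¹ ∙ a ⁻¹ ⁻¹   ≡⟨ cong (b ⁻¹ ∙_) (⁻¹-involutive a) ⟩
        b ⁻¹ ∙ a         ∎) (⁻¹-closed a≡b)
        where open ≡-Reasoning

      ≡ᴺ-trans : ∀ {a b c} → a ≡ᴺ b → b ≡ᴺ c → a ≡ᴺ c
      ≡ᴺ-trans {a} {b} {c} a≡b b≡c = subst (_∈ N) (begin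
        a ⁻¹ ∙ b ∙ (b ⁻¹ ∙ c)    ≡⟨ assoc (a ⁻¹) b (b ⁻¹ ∙ c) ⟩
        a ⁻¹ ∙ (b ∙ (b ⁻¹ ∙ c))  ≡⟨ cong (a ⁻¹ ∙_) (\\-leftDividesˡ b c) ⟩
        a ⁻¹ ∙ c                 ∎) (∙-closed a≡b b≡c)
        where open ≡-Reasoning

      ≡ᴺ-∙-congʳ : ∀ c {a b} → a ≡ᴺ b → a ∙ c ≡ᴺ b ∙ c
      ≡ᴺ-∙-congʳ c {a} {b} a≡b = subst (_∈ N) (begin
        c ⁻¹ ∙ (a ⁻¹ ∙ b) ∙ c ⁻¹ ⁻¹  ≡⟨ cong (c ⁻¹ ∙ (a ⁻¹ ∙ b) ∙_) (⁻¹-involutive c) ⟩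
        c ⁻¹ ∙ (a ⁻¹ ∙ b) ∙ c        ≡⟨ cong (_∙ c) (assoc (c ⁻¹) (a ⁻¹) b) ⟨
        c ⁻¹ ∙ a ⁻¹ ∙ b ∙ c          ≡⟨ assoc (c ⁻¹ ∙ a ⁻¹) b c ⟩
        c ⁻¹ ∙ a ⁻¹ ∙ (b ∙ c)        ≡⟨ cong (_∙ (b ∙ c)) (⁻¹-anti-homo-∙ a c) ⟨
        (a ∙ c) ⁻¹ ∙ (b ∙ c)         ∎) (conj-closed (c ⁻¹) a≡b)
        where open ≡-Reasoning

      -- y x = x⁻¹ (x y) x, and conjugation by x fixes the central coset g N.
      central-swap : ∀ {g x y} → CentralMod G N g → g ≡ᴺ x ∙ y → g ≡ᴺ y ∙ x
      central-swap {g} {x} {y} central g≡xy = ≡ᴺ-trans g≡x⁻¹gx x⁻¹gx≡yx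
        where
        g≡x⁻¹gx : g ≡ᴺ x ⁻¹ ∙ g ∙ x
        g≡x⁻¹gx = ≡ᴺ-sym (≡ᴺ-respʳ (\\-leftDividesʳ x g)
                            (≡ᴺ-respˡ (sym (assoc (x ⁻¹) g x)) (≡ᴺ-∙-congˡ (x ⁻¹) (central x))))
        x⁻¹gx≡yx : x ⁻¹ ∙ g ∙ x ≡ᴺ y ∙ x
        x⁻¹gx≡yx = ≡ᴺ-respʳ (cong (_∙ x) (\\-leftDividesʳ x y)) (≡ᴺ-∙-congʳ x (≡ᴺ-∙-congˡ (x ⁻¹) g≡xy))

      nonsquare⇒≢ᴺ² : ∀ {g} → ¬ SquareMod G N g → ∀ x → ¬ (g ≡ᴺ x ∙ x)
      nonsquare⇒≢ᴺ² nonsquare x g≡xx = nonsquare (x , ≡ᴺ-sym g≡xx)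

      nonsquare⇒∙≢ε : ∀ {g m} → ¬ SquareMod G N g → m ∈ N → g ∙ m ≢ ε
      nonsquare⇒∙≢ε {g} {m} nonsquare m∈N gm≡ε =
        nonsquare⇒≢ᴺ² nonsquare ε (≡ᴺ-respʳ (trans gm≡ε (sym (identityˡ ε))) g≡gm)
        where
        g≡gm : g ≡ᴺ g ∙ m
        g≡gm = subst (_∈ N) (sym (\\-leftDividesʳ g m)) m∈N

lemma3p3 : (n : ℕ) (G : FinGroup n) (N : Subset n) (S : Subset n) (k μ : ℕ) →
    IsNormalSubgroup G N → IsSumSet G S k μ →
    (∃[ g ] (CentralMod G N g × ¬ SquareMod G N g)) →
    2 ∣ μ * ∣ N ∣
lemma3p3 n G N S k μ N-normal (_ , reps≡μ) (g , central , nonsquare) =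
  subst (2 ∣_) pairs≡μ∣N∣ (2∣∑∑-symmetric-hollow pairs pairs-sym pairs-diag)
  where
  open FinGroup G
  open Cosets G N
  open Normal N-normal
  open ≡-Reasoning

  pairs : Fin n → Fin n → ℕ
  pairs x y = 𝟙 (coset-factorisation? S g x y)

  pairs-sym : ∀ x y → pairs x y ≡ pairs y x
  pairs-sym x y = 𝟙-cong (coset-factorisation? S g x y) (coset-factorisation? S g y x)
    (λ (x∈S , y∈S , g≡xy) → y∈S , x∈S , central-swap central g≡xy)
    (λ (y∈S , x∈S , g≡yx) → x∈S , y∈S , central-swap central g≡yx)

  pairs-diag : ∀ x → pairs x x ≡ 0
  pairs-diag x = 𝟙-reject (coset-factorisation? S g x x) (λ (_ , _ , g≡xx) → nonsquare⇒≢ᴺ² nonsquare x g≡xx)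

  pairs≡μ∣N∣ : ∑[ x < n ] ∑[ y < n ] pairs x y ≡ μ * ∣ N ∣
  pairs≡μ∣N∣ = begin
    ∑[ x < n ] ∑[ y < n ] pairs x y           ≡⟨ ∑-reps-translate S g ⟨
    ∑[ m < n ] (𝟙 (m ∈? N) * reps G S (g ∙ m)) ≡⟨ sum-cong-≗ (λ m → 𝟙-*-congˡ (m ∈? N)
                                                    (λ m∈N → reps≡μ (g ∙ m) (nonsquare⇒∙≢ε nonsquare m∈N))) ⟩
    ∑[ m < n ] (𝟙 (m ∈? N) * μ)                ≡⟨ *-distribʳ-sum μ (λ m → 𝟙 (m ∈? N)) ⟨
    ∑[ m < n ] 𝟙 (m ∈? N) * μ                  ≡⟨ cong (_* μ) (∣p∣≡∑𝟙∈ N) ⟨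
    ∣ N ∣ * μ                                  ≡⟨ *-comm ∣ N ∣ μ ⟩
    μ * ∣ N ∣                                  ∎
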